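{- Let $p\ge2$, $n=3p$, and let $b,c$ be integers with $b\ge1$, $c\ge0$, $b+c\le p-2$. For $i\in\mathbb{Z}$ let $\overline i\in[n]$ with $\overline i\equiv i\pmod n$. Let $\Sigma=\langle\{\{\overline i,\overline{i+p},\overline{i+2p}\}: i=1,\dots,p\}\rangle$, for $1\le i\le n$, $1\le j\le p-1$ let $\Delta(i,j)=\langle\{\overline i,\overline{i+p},\overline{i+j+p}\},\{\overline{i+j+p},\overline{i+j+2p},\overline i\}\rangle$, $\mathcal L=\{\Delta(i,j)\}$, $\mathcal M=\mathcal L\setminus\{\Delta(1,1),\dots,\Delta(1,b)\}$, $\Gamma=\Sigma\cup\bigcup_{\Delta(i,j)\in\mathcal M}\Delta(i,j)$, $G_j=\{1+p,1+j+p,1+j+2p\}$ for $1\le j\le p-2$, and $\Delta=\Gamma\cup\langle G_{b+1}\rangle\cup\cdots\cup\langle G_{b+c}\rangle$. Then (i) $\Delta\cap\langle G_b\rangle=\langle\{1+p,1+b+2p\},\{1+b+p,1+b+2p\}\rangle$; (ii) $(\Delta\cup\langle G_b\rangle)\cap\langle\{1,1+p,1+b+p\}\rangle=\langle\{1,1+p\},\{1+p,1+b+p\}\rangle$.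
   Context: For a collection $C$ of subsets of $[n]$, $\langle C\rangle$ denotes the simplicial complex generated by $C$; $\langle F\rangle=\langle\{F\}\rangle$. -}

module Defs where

open import Data.Nat using (ℕ; suc; _+_; _*_; _∸_; _≤_; NonZero)
open import Data.Nat.Properties using (m*n≢0)
open import Data.Nat.DivMod using (_mod_)
open import Data.Fin using (Fin)
open import Data.Fin.Subset using (Subset; _⊆_; ⁅_⁆; _∪_)
open import Data.Product using (_×_; ∃; ∃-syntax)
open import Data.Sum using (_⊎_)
open import Relation.Nullary using (¬_)
open import Function.Bundles using (_⇔_)

-- Vertex set [n] = {1,…,n} is modelled by Fin n, vertex v ↦ v - 1.
-- Faces are subsets of [n]; a simplicial complex is a predicate on faces.
Complex : ℕ → Set₁
Complex n = Subset n → Set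

N : ℕ → ℕ
N p = 3 * p

bar : (p : ℕ) .{{_ : NonZero p}} → ℕ → Fin (N p)
bar p i = _mod_ (i ∸ 1) (3 * p) {{m*n≢0 3 p}}

pair : (p : ℕ) .{{_ : NonZero p}} → ℕ → ℕ → Subset (N p)
pair p a b = ⁅ bar p a ⁆ ∪ ⁅ bar p b ⁆

tri : (p : ℕ) .{{_ : NonZero p}} → ℕ → ℕ → ℕ → Subset (N p)
tri p a b c = ⁅ bar p a ⁆ ∪ (⁅ bar p b ⁆ ∪ ⁅ bar p c ⁆)

⟨_⟩ : ∀ {n} → Subset n → Complex n
⟨ G ⟩ F = F ⊆ G

_∪ᶜ_ : ∀ {n} → Complex n → Complex n → Complex n
(A ∪ᶜ B) F = A F ⊎ B F

_∩ᶜ_ : ∀ {n} → Complex n → Complex n → Complex n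
(A ∩ᶜ B) F = A F × B F

_≐_ : ∀ {n} → Complex n → Complex n → Set
A ≐ B = ∀ F → A F ⇔ B F

Sig : (p : ℕ) .{{_ : NonZero p}} → Complex (N p)
Sig p F = ∃[ i ] (1 ≤ i × i ≤ p × F ⊆ tri p i (i + p) (i + 2 * p))

Dij : (p : ℕ) .{{_ : NonZero p}} → ℕ → ℕ → Complex (N p)
Dij p i j F = F ⊆ tri p i (i + p) (i + j + p) ⊎ F ⊆ tri p (i + j + p) (i + j + 2 * p) i

-- membership of a complex D in 𝓛 = {Δ(i,j) : 1 ≤ i ≤ n, 1 ≤ j ≤ p-1}
-- (as complexes, i.e. up to equality ≐)
-- 𝓜 = 𝓛 ∖ {Δ(1,1),…,Δ(1,b)} : D is some Δ(i,j) with (i,j) in range, and D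
-- differs (as a complex) from every Δ(1,k), 1 ≤ k ≤ b.
InM : (p : ℕ) .{{_ : NonZero p}} → ℕ → Complex (N p) → Set
InM p b D =
  (∃[ i ] ∃[ j ] (1 ≤ i × i ≤ N p × 1 ≤ j × j ≤ p ∸ 1 × D ≐ Dij p i j))
  × (∀ k → 1 ≤ k → k ≤ b → ¬ (D ≐ Dij p 1 k))

Gam : (p : ℕ) .{{_ : NonZero p}} → ℕ → Complex (N p)
Gam p b F = Sig p F ⊎ ∃[ i ] ∃[ j ] (InM p b (Dij p i j) × Dij p i j F)

Gj : (p : ℕ) .{{_ : NonZero p}} → ℕ → Subset (N p)
Gj p j = tri p (1 + p) (1 + j + p) (1 + j + 2 * p)

Del : (p : ℕ) .{{_ : NonZero p}} → ℕ → ℕ → Complex (N p)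
Del p b c F = Gam p b F ⊎ ∃[ j ] (b + 1 ≤ j × j ≤ b + c × ⟨ Gj p j ⟩ F)

module Submission where

-- Vertices are 0-based: v x is the vertex (x+1)‾, the class of x modulo
-- n = 3p.  Every Δ(x+1,k) is generated by the two triangles
--   T x k = {x, x+p, x+k+p}   and   T (x+k+p) (p-k),
-- and either triangle determines the pair (the flip D x k ≐ D (x+k+p) (p-k)).
--
-- The heart of the proof is that Δ contains neither the edge {p, b+p} nor the
-- edge {0, b+p}.  Their endpoints have residues 0 and b ≠ 0 modulo p, which
-- rules out the triangles of Σ and the G_j, and forces a triangle T x k
-- containing such an edge to have one endpoint in its base {x, x+p} and the
-- other at its apex; a computation modulo n then shows that T x k is a
-- triangle of Δ(1,b), so the Δ(i,j) containing it is Δ(1,b), which is not in 𝓜.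
-- Both parts then follow by splitting a face of a triangle according to which
-- endpoints of the missing edge it contains.

open import Defs
open import Data.Nat using (>-nonZero⁻¹; ℕ; zero; suc; pred; _+_; _*_; _∸_; _≤_; _<_; _%_; NonZero; z≤n; s≤s)
open import Data.Nat.Properties
open import Data.Nat.DivMod using (%-distribˡ-+; [m+kn]%n≡m%n; [m+n]%n≡m%n; m<n⇒m%n≡m; n%n≡0; m∣n⇒o%n%m≡o%m)
open import Data.Nat.Divisibility using (_∣_; divides)
open import Data.Nat.Tactic.RingSolver using (solve-∀)
open import Data.Fin using (Fin; toℕ)
open import Data.Fin.Properties using (toℕ-injective; toℕ-fromℕ<)
open import Data.Fin.Subset using (Subset; _⊆_; _∈_; _∉_; ⁅_⁆; _∪_)
open import Data.Fin.Subset.Properties using (⊆-trans; x∈⁅x⁆; x∈⁅y⁆⇒x≡y; x∈p∪q⁻; x∈p∪q⁺; _∈?_)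
open import Data.Product using (_×_; _,_)
open import Data.Sum using (_⊎_; inj₁; inj₂; swap)
open import Data.Empty using (⊥; ⊥-elim)
open import Relation.Nullary using (¬_; yes; no)
open import Relation.Binary.PropositionalEquality
open import Function.Bundles using (mk⇔; Equivalence)

-- Congruence modulo a positive modulus

module Congruence (n : ℕ) .{{_ : NonZero n}} where

  rem : ℕ → ℕ
  rem x = x % n

  infix 4 _≋_
  _≋_ : ℕ → ℕ → Set
  x ≋ y = rem x ≡ rem y

  ≡⇒≋ : ∀ {x y} → x ≡ y → x ≋ y
  ≡⇒≋ = cong (_% n)

  +-≋ : ∀ {x x′ y y′} → x ≋ x′ → y ≋ y′ → x + y ≋ x′ + y′
  +-≋ {x} {x′} {y} {y′} ex ey = begin
    (x + y) % n            ≡⟨ %-distribˡ-+ x y n ⟩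
    (x % n + y % n) % n    ≡⟨ cong₂ (λ s t → (s + t) % n) ex ey ⟩
    (x′ % n + y′ % n) % n  ≡⟨ %-distribˡ-+ x′ y′ n ⟨
    (x′ + y′) % n          ∎
    where open ≡-Reasoning

  +ʳ-≋ : ∀ z {x y} → x ≋ y → x + z ≋ y + z
  +ʳ-≋ z e = +-≋ e refl

  +-multiple : ∀ x k → x + k * n ≋ x
  +-multiple x k = [m+kn]%n≡m%n x k n

  -- Translation is injective on classes: add z·(n-1) to undo the shift by z.
  +ʳ-cancel : ∀ z {x y} → x + z ≋ y + z → x ≋ y
  +ʳ-cancel z {x} {y} e = begin
    x % n                     ≡⟨ +-multiple x z ⟨
    (x + z * n) % n           ≡⟨ cong (_% n) (unfold x) ⟩
    (x + z + z * pred n) % n  ≡⟨ +ʳ-≋ (z * pred n) e ⟩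
    (y + z + z * pred n) % n  ≡⟨ cong (_% n) (unfold y) ⟨
    (y + z * n) % n           ≡⟨ +-multiple y z ⟩
    y % n                     ∎
    where
    open ≡-Reasoning
    unfold : ∀ t → t + z * n ≡ t + z + z * pred n
    unfold t = begin
      t + z * n             ≡⟨ cong (λ m → t + z * m) (suc-pred n) ⟨
      t + z * suc (pred n)  ≡⟨ cong (t +_) (*-suc z (pred n)) ⟩
      t + (z + z * pred n)  ≡⟨ +-assoc t z (z * pred n) ⟨
      t + z + z * pred n    ∎

  ≋⇒%≡ : ∀ d .{{_ : NonZero d}} → d ∣ n → ∀ {x y} → x ≋ y → x % d ≡ y % d
  ≋⇒%≡ d d∣n {x} {y} e = trans (sym (m∣n⇒o%n%m≡o%m d n x d∣n))
                              (trans (cong (_% d) e) (m∣n⇒o%n%m≡o%m d n y d∣n))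

  ≋⇒≡ : ∀ {x y} → x < n → y < n → x ≋ y → x ≡ y
  ≋⇒≡ x<n y<n e = trans (sym (m<n⇒m%n≡m x<n)) (trans e (m<n⇒m%n≡m y<n))

edge : ∀ {m} → Fin m → Fin m → Subset m
edge a b = ⁅ a ⁆ ∪ ⁅ b ⁆

triangle : ∀ {m} → Fin m → Fin m → Fin m → Subset m
triangle a b c = ⁅ a ⁆ ∪ (⁅ b ⁆ ∪ ⁅ c ⁆)

∈edge⁻ : ∀ {m} {a b w : Fin m} → w ∈ edge a b → w ≡ a ⊎ w ≡ b
∈edge⁻ {a = a} {b = b} h with x∈p∪q⁻ ⁅ a ⁆ ⁅ b ⁆ h
... | inj₁ h₁ = inj₁ (x∈⁅y⁆⇒x≡y a h₁)
... | inj₂ h₂ = inj₂ (x∈⁅y⁆⇒x≡y b h₂)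

∈triangle⁻ : ∀ {m} {a b c w : Fin m} → w ∈ triangle a b c → w ≡ a ⊎ w ≡ b ⊎ w ≡ c
∈triangle⁻ {a = a} {b = b} {c = c} h with x∈p∪q⁻ ⁅ a ⁆ (⁅ b ⁆ ∪ ⁅ c ⁆) h
... | inj₁ h₁ = inj₁ (x∈⁅y⁆⇒x≡y a h₁)
... | inj₂ h₂ = inj₂ (∈edge⁻ h₂)

∈ˡ : ∀ {m} {a b w : Fin m} → w ≡ a → w ∈ edge a b
∈ˡ {w = w} refl = x∈p∪q⁺ (inj₁ (x∈⁅x⁆ w))

∈ʳ : ∀ {m} {a b w : Fin m} → w ≡ b → w ∈ edge a b
∈ʳ {w = w} refl = x∈p∪q⁺ (inj₂ (x∈⁅x⁆ w))

∈₁ : ∀ {m} {a b c w : Fin m} → w ≡ a → w ∈ triangle a b c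
∈₁ {w = w} refl = x∈p∪q⁺ (inj₁ (x∈⁅x⁆ w))

∈₂ : ∀ {m} {a b c w : Fin m} → w ≡ b → w ∈ triangle a b c
∈₂ {w = w} refl = x∈p∪q⁺ (inj₂ (x∈p∪q⁺ (inj₁ (x∈⁅x⁆ w))))

∈₃ : ∀ {m} {a b c w : Fin m} → w ≡ c → w ∈ triangle a b c
∈₃ {w = w} refl = x∈p∪q⁺ (inj₂ (x∈p∪q⁺ (inj₂ (x∈⁅x⁆ w))))

triangle-cong : ∀ {m} {a b c a′ b′ c′ : Fin m} → a ≡ a′ → b ≡ b′ → c ≡ c′ → triangle a b c ≡ triangle a′ b′ c′
triangle-cong refl refl refl = refl

edge-⊆ : ∀ {m} {a b : Fin m} {S} → a ∈ S → b ∈ S → edge a b ⊆ S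
edge-⊆ a∈S b∈S x∈ with ∈edge⁻ x∈
... | inj₁ refl = a∈S
... | inj₂ refl = b∈S

triangle-⊆ : ∀ {m} {a b c : Fin m} {S} → a ∈ S → b ∈ S → c ∈ S → triangle a b c ⊆ S
triangle-⊆ a∈S b∈S c∈S x∈ with ∈triangle⁻ x∈
... | inj₁ refl = a∈S
... | inj₂ (inj₁ refl) = b∈S
... | inj₂ (inj₂ refl) = c∈S

drop-first : ∀ {m} {a b c : Fin m} {F} → F ⊆ triangle a b c → a ∉ F → F ⊆ edge b c
drop-first F⊆ a∉F x∈F with ∈triangle⁻ (F⊆ x∈F)
... | inj₁ refl = ⊥-elim (a∉F x∈F)
... | inj₂ (inj₁ e) = ∈ˡ e
... | inj₂ (inj₂ e) = ∈ʳ e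

drop-second : ∀ {m} {a b c : Fin m} {F} → F ⊆ triangle a b c → b ∉ F → F ⊆ edge a c
drop-second F⊆ b∉F x∈F with ∈triangle⁻ (F⊆ x∈F)
... | inj₁ e = ∈ˡ e
... | inj₂ (inj₁ refl) = ⊥-elim (b∉F x∈F)
... | inj₂ (inj₂ e) = ∈ʳ e

avoid-edge : ∀ {m} {a b c : Fin m} {F} → F ⊆ triangle a b c → ¬ (a ∈ F × b ∈ F) → F ⊆ edge a c ⊎ F ⊆ edge b c
avoid-edge {a = a} {b = b} {F = F} F⊆ no-ab with a ∈? F
... | no a∉F = inj₂ (drop-first F⊆ a∉F)
... | yes a∈F with b ∈? F
...   | no b∉F = inj₁ (drop-second F⊆ b∉F)
...   | yes b∈F = ⊥-elim (no-ab (a∈F , b∈F))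

module _ {n : ℕ} where

  ≐-refl : {A : Complex n} → A ≐ A
  ≐-refl F = mk⇔ (λ x → x) (λ x → x)

  ≐-sym : {A B : Complex n} → A ≐ B → B ≐ A
  ≐-sym e F = mk⇔ (Equivalence.from (e F)) (Equivalence.to (e F))

  ≐-trans : {A B C : Complex n} → A ≐ B → B ≐ C → A ≐ C
  ≐-trans e₁ e₂ F = mk⇔ (λ x → Equivalence.to (e₂ F) (Equivalence.to (e₁ F) x))
                        (λ x → Equivalence.from (e₁ F) (Equivalence.from (e₂ F) x))

  ⟨⟩∪⟨⟩-cong : {A A′ B B′ : Subset n} → A ≡ A′ → B ≡ B′ → (⟨ A ⟩ ∪ᶜ ⟨ B ⟩) ≐ (⟨ A′ ⟩ ∪ᶜ ⟨ B′ ⟩)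
  ⟨⟩∪⟨⟩-cong refl refl = ≐-refl

  ⟨⟩∪⟨⟩-comm : {A B : Subset n} → (⟨ A ⟩ ∪ᶜ ⟨ B ⟩) ≐ (⟨ B ⟩ ∪ᶜ ⟨ A ⟩)
  ⟨⟩∪⟨⟩-comm F = mk⇔ swap swap

-- Vertices, residues and the triangles of the complexes Δ(i,j)

module Geometry (p : ℕ) .{{_ : NonZero p}} where

  n : ℕ
  n = N p

  open Congruence n {{m*n≢0 3 p}} public

  v : ℕ → Fin n
  v x = bar p (suc x)

  toℕ-v : ∀ x → toℕ (v x) ≡ rem x
  toℕ-v x = toℕ-fromℕ< _

  v-≋ : ∀ {x y} → v x ≡ v y → x ≋ y
  v-≋ {x} {y} e = trans (sym (toℕ-v x)) (trans (cong toℕ e) (toℕ-v y))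

  ≋-v : ∀ {x y} → x ≋ y → v x ≡ v y
  ≋-v {x} {y} e = toℕ-injective (trans (toℕ-v x) (trans e (sym (toℕ-v y))))

  +3p : ∀ x → x + p + p + p ≋ x
  +3p x = trans (≡⇒≋ (identity x p)) (+-multiple x 1)
    where
    identity : ∀ x p → x + p + p + p ≡ x + 1 * (3 * p)
    identity = solve-∀

  ρ : ℕ → ℕ
  ρ t = t % p

  ρ-≋ : ∀ {x y} → x ≋ y → ρ x ≡ ρ y
  ρ-≋ = ≋⇒%≡ p (divides 3 refl)

  ρ-+p : ∀ x → ρ (x + p) ≡ ρ x
  ρ-+p x = [m+n]%n≡m%n x p

  ρ-+2p : ∀ x → ρ (x + 2 * p) ≡ ρ x
  ρ-+2p x = [m+kn]%n≡m%n x 2 p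

  ρ-< : ∀ {x} → x < p → ρ x ≡ x
  ρ-< = m<n⇒m%n≡m

  ρ-Σ : ∀ {a t} → v t ∈ triangle (v a) (v (a + p)) (v (a + 2 * p)) → ρ t ≡ ρ a
  ρ-Σ {a} h with ∈triangle⁻ h
  ... | inj₁ e = ρ-≋ (v-≋ e)
  ... | inj₂ (inj₁ e) = trans (ρ-≋ (v-≋ e)) (ρ-+p a)
  ... | inj₂ (inj₂ e) = trans (ρ-≋ (v-≋ e)) (ρ-+2p a)

  T : ℕ → ℕ → Subset n
  T x k = triangle (v x) (v (x + p)) (v (x + k + p))

  T-cong : ∀ {x x′ k k′} → x ≋ x′ → k ≡ k′ → T x k ≡ T x′ k′
  T-cong {k = k} e refl = triangle-cong (≋-v e) (≋-v (+ʳ-≋ p e)) (≋-v (+ʳ-≋ p (+ʳ-≋ k e)))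

  opposite-apex : ∀ x k → k ≤ p → x + k + p + (p ∸ k) + p ≋ x
  opposite-apex x k k≤p = trans (≡⇒≋ eq) (+3p x)
    where
    regroup : ∀ x k d p → x + k + p + d + p ≡ x + (k + d) + p + p
    regroup = solve-∀
    eq : x + k + p + (p ∸ k) + p ≡ x + p + p + p
    eq = trans (regroup x k (p ∸ k) p) (cong (λ s → x + s + p + p) (m+[n∸m]≡n k≤p))

  D : ℕ → ℕ → Complex n
  D x k = ⟨ T x k ⟩ ∪ᶜ ⟨ T (x + k + p) (p ∸ k) ⟩

  Dij≐D : ∀ a j → j ≤ p → Dij p (suc a) j ≐ D a j
  Dij≐D a j j≤p = ⟨⟩∪⟨⟩-cong {A = T a j} refl second
    where
    regroup : ∀ a j p → a + j + 2 * p ≡ a + j + p + p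
    regroup = solve-∀
    second : tri p (suc a + j + p) (suc a + j + 2 * p) (suc a) ≡ T (a + j + p) (p ∸ j)
    second = triangle-cong refl (≋-v (≡⇒≋ (regroup a j p))) (≋-v (sym (opposite-apex a j j≤p)))

  D-shift : ∀ {x x′} k → x ≋ x′ → D x k ≐ D x′ k
  D-shift k e = ⟨⟩∪⟨⟩-cong (T-cong e refl) (T-cong (+ʳ-≋ p (+ʳ-≋ k e)) refl)

  D-flip : ∀ x k → k ≤ p → D x k ≐ D (x + k + p) (p ∸ k)
  D-flip x k k≤p = ≐-trans ⟨⟩∪⟨⟩-comm
    (⟨⟩∪⟨⟩-cong refl (sym (T-cong (opposite-apex x k k≤p) (m∸[m∸n]≡n k≤p))))

  Base : ℕ → ℕ → Set
  Base x t = t ≋ x ⊎ t ≋ x + p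

  InT : ℕ → ℕ → ℕ → Set
  InT x k t = Base x t ⊎ t ≋ x + k + p

  ∈T⇒InT : ∀ {x k t} → v t ∈ T x k → InT x k t
  ∈T⇒InT h with ∈triangle⁻ h
  ... | inj₁ e = inj₁ (inj₁ (v-≋ e))
  ... | inj₂ (inj₁ e) = inj₁ (inj₂ (v-≋ e))
  ... | inj₂ (inj₂ e) = inj₂ (v-≋ e)

  ρ-base : ∀ {x t} → Base x t → ρ t ≡ ρ x
  ρ-base (inj₁ e) = ρ-≋ e
  ρ-base {x} (inj₂ e) = trans (ρ-≋ e) (ρ-+p x)

  base-and-apex : ∀ {x k u w} → InT x k u → InT x k w → ρ u ≢ ρ w →
                  (Base x u × w ≋ x + k + p) ⊎ (u ≋ x + k + p × Base x w)
  base-and-apex (inj₁ bu) (inj₁ bw) ρ≢ = ⊥-elim (ρ≢ (trans (ρ-base bu) (sym (ρ-base bw))))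
  base-and-apex (inj₁ bu) (inj₂ aw) ρ≢ = inj₁ (bu , aw)
  base-and-apex (inj₂ au) (inj₁ bw) ρ≢ = inj₂ (au , bw)
  base-and-apex (inj₂ au) (inj₂ aw) ρ≢ = ⊥-elim (ρ≢ (ρ-≋ (trans au (sym aw))))

  swap-p : ∀ y k → y + p + k ≡ y + k + p
  swap-p y k = solution y p k
    where
    solution : ∀ y p k → y + p + k ≡ y + k + p
    solution = solve-∀

  apex-at : ∀ {x y} k → x ≋ y → x + k + p ≋ y + k + p
  apex-at {x} {y} k e = +ʳ-≋ p (+ʳ-≋ k e)

  0<p : 0 < p
  0<p = >-nonZero⁻¹ p

  <n : ∀ {x} → x < p + p + p → x < n
  <n {x} = subst (x <_) (three-p p)
    where
    three-p : ∀ p → p + p + p ≡ 3 * p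
    three-p = solve-∀

  <2p⇒+p<n : ∀ {x} → x < p + p → x + p < n
  <2p⇒+p<n x<2p = <n (+-monoˡ-< _ x<2p)

  <2p⇒<n : ∀ {x} → x < p + p → x < n
  <2p⇒<n x<2p = <n (<-≤-trans x<2p (m≤m+n _ _))

  <p⇒<n : ∀ {x} → x < p → x < n
  <p⇒<n x<p = <2p⇒<n (<-≤-trans x<p (m≤m+n p p))

  ¬0≋ : ∀ {s} → 0 < s → s < n → ¬ (0 ≋ s)
  ¬0≋ 0<s s<n e = <⇒≢ 0<s (≋⇒≡ (<p⇒<n 0<p) s<n e)

  2p≉0 : ¬ (p + p ≋ 0)
  2p≉0 e = ¬0≋ (≤-trans 0<p (m≤m+n p p)) (<n (m<m+n (p + p) 0<p)) (sym e)

  2p≉p : ¬ (p + p ≋ p)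
  2p≉p e = ¬0≋ 0<p (<2p⇒<n (m<m+n p 0<p)) (sym (+ʳ-cancel p e))

  ρ-2p≢ : ∀ {k} → 1 ≤ k → ρ (p + p) ≢ k
  ρ-2p≢ 1≤k e = <⇒≢ 1≤k (trans (sym (trans (ρ-+p p) (n%n≡0 p))) e)

  -- 2p (0-based) is not a vertex of Δ(1,k) = D 0 k for 1 ≤ k < p: it has
  -- residue 0, and the only vertices of residue 0 of Δ(1,k) are 0 and p.
  2p∉D0k : ∀ {k F} → 1 ≤ k → k < p → D 0 k F → v (p + p) ∉ F
  2p∉D0k {k} 1≤k k<p (inj₁ F⊆) h with ∈T⇒InT (F⊆ h)
  ... | inj₁ (inj₁ e) = 2p≉0 e
  ... | inj₁ (inj₂ e) = 2p≉p e
  ... | inj₂ e = ρ-2p≢ 1≤k (trans (ρ-≋ e) (trans (ρ-+p k) (ρ-< k<p)))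
  2p∉D0k {k} 1≤k k<p (inj₂ F⊆) h with ∈T⇒InT (F⊆ h)
  ... | inj₁ (inj₁ e) = ρ-2p≢ 1≤k (trans (ρ-≋ e) (trans (ρ-+p k) (ρ-< k<p)))
  ... | inj₁ (inj₂ e) = ρ-2p≢ 1≤k
                          (trans (ρ-≋ e) (trans (ρ-+p (k + p)) (trans (ρ-+p k) (ρ-< k<p))))
  ... | inj₂ e = 2p≉0 (trans e (opposite-apex 0 k (<⇒≤ k<p)))

  -- The missing edges {p, b+p} and {0, b+p}, for 1 ≤ b < p

  module MissingEdges (b : ℕ) (1≤b : 1 ≤ b) (b<p : b < p) where

    0<b+k+p : ∀ k → 0 < b + k + p
    0<b+k+p k = ≤-trans 1≤b (≤-trans (m≤m+n b k) (m≤m+n (b + k) p))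

    ρ-b+p : ρ (b + p) ≡ b
    ρ-b+p = trans (ρ-+p b) (ρ-< b<p)

    Pole : ℕ → Set
    Pole u = u ≡ 0 ⊎ u ≡ p

    ρ-pole : ∀ {u} → Pole u → ρ u ≡ 0
    ρ-pole (inj₁ refl) = ρ-< 0<p
    ρ-pole (inj₂ refl) = n%n≡0 p

    pole≢b+p : ∀ {u} → Pole u → ρ u ≢ ρ (b + p)
    pole≢b+p pole e = <⇒≢ 1≤b (sym (trans (sym ρ-b+p) (trans (sym e) (ρ-pole pole))))

    OfΔ1b : ℕ → ℕ → Set
    OfΔ1b x k = (x ≋ 0 × k ≡ b) ⊎ (x ≋ b + p × k ≡ p ∸ b)

    OfΔ1b⇒≐ : ∀ {x k} → OfΔ1b x k → D x k ≐ D 0 b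
    OfΔ1b⇒≐ (inj₁ (e , refl)) = D-shift b e
    OfΔ1b⇒≐ {k = k} (inj₂ (e , refl)) = ≐-trans (D-shift k e) (≐-sym (D-flip 0 b (<⇒≤ b<p)))

    edge-p : ∀ {x k} → k < p → InT x k p → InT x k (b + p) → OfΔ1b x k
    edge-p {x} {k} k<p u w with base-and-apex u w (pole≢b+p (inj₂ refl))
    ... | inj₁ (inj₁ p≋x , w≋) = ⊥-elim (<⇒≢ (<-≤-trans b<p (m≤m+n p k)) b≡p+k)
      where
      b≡p+k : b ≡ p + k
      b≡p+k = ≋⇒≡ (<p⇒<n b<p) (<2p⇒<n (+-monoʳ-< p k<p))
                  (+ʳ-cancel p (trans w≋ (apex-at k (sym p≋x))))
    ... | inj₁ (inj₂ p≋x+p , w≋) = inj₁ (x≋0 , sym b≡k)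
      where
      x≋0 : x ≋ 0
      x≋0 = +ʳ-cancel p (sym p≋x+p)
      b≡k : b ≡ k
      b≡k = ≋⇒≡ (<p⇒<n b<p) (<p⇒<n k<p) (+ʳ-cancel p (trans w≋ (apex-at k x≋0)))
    ... | inj₂ (p≋ , inj₁ w≋x) = ⊥-elim (¬0≋ (0<b+k+p k) (<2p⇒+p<n (+-mono-< b<p k<p))
            (+ʳ-cancel p (trans p≋ (trans (apex-at k (sym w≋x)) (≡⇒≋ (cong (_+ p) (swap-p b k)))))))
    ... | inj₂ (p≋ , inj₂ w≋x+p) = ⊥-elim (¬0≋ (≤-trans 1≤b (m≤m+n b k)) (<2p⇒<n (+-mono-< b<p k<p))
            (+ʳ-cancel p (trans p≋ (apex-at k (sym (+ʳ-cancel p w≋x+p))))))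

    edge-0 : ∀ {x k} → k < p → InT x k 0 → InT x k (b + p) → OfΔ1b x k
    edge-0 {x} {k} k<p u w with base-and-apex u w (pole≢b+p (inj₁ refl))
    ... | inj₁ (inj₁ 0≋x , w≋) = inj₁ (sym 0≋x , sym b≡k)
      where
      b≡k : b ≡ k
      b≡k = ≋⇒≡ (<p⇒<n b<p) (<p⇒<n k<p) (+ʳ-cancel p (trans w≋ (apex-at k (sym 0≋x))))
    ... | inj₁ (inj₂ 0≋x+p , w≋) = ⊥-elim (<⇒≢ (<-≤-trans k<p (m≤n+m p b)) (sym b+p≡k))
      where
      b+p≡k : b + p ≡ k
      b+p≡k = ≋⇒≡ (<2p⇒<n (+-monoˡ-< p b<p)) (<p⇒<n k<p) (+ʳ-cancel p
                (trans (+ʳ-≋ p w≋) (trans (≡⇒≋ (cong (_+ p) (sym (swap-p x k))))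
                                          (apex-at k (sym 0≋x+p)))))
    ... | inj₂ (0≋ , inj₁ w≋x) = inj₂ (sym w≋x , k≡p∸b)
      where
      around : b + p + k + p + p ≋ b + k
      around = trans (≡⇒≋ (cong (λ s → s + p + p) (swap-p b k))) (+3p (b + k))
      p≡b+k : p ≡ b + k
      p≡b+k = ≋⇒≡ (<2p⇒<n (m<m+n p 0<p)) (<2p⇒<n (+-mono-< b<p k<p))
                  (trans (+ʳ-≋ p 0≋) (trans (+ʳ-≋ p (apex-at k (sym w≋x))) around))
      k≡p∸b : k ≡ p ∸ b
      k≡p∸b = sym (trans (cong (_∸ b) p≡b+k) (m+n∸m≡n b k))
    ... | inj₂ (0≋ , inj₂ w≋x+p) = ⊥-elim (¬0≋ (0<b+k+p k)
            (<2p⇒+p<n (+-mono-< b<p k<p)) (trans 0≋ (apex-at k (sym (+ʳ-cancel p w≋x+p)))))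

    edge-pole : ∀ {u x k} → Pole u → k < p → InT x k u → InT x k (b + p) → OfΔ1b x k
    edge-pole (inj₁ refl) = edge-0
    edge-pole (inj₂ refl) = edge-p

    edge-in-D : ∀ {u a j F} → Pole u → 1 ≤ j → j < p →
                D a j F → v u ∈ F → v (b + p) ∈ F → D a j ≐ D 0 b
    edge-in-D pole 1≤j j<p (inj₁ F⊆) u∈F w∈F =
      OfΔ1b⇒≐ (edge-pole pole j<p (∈T⇒InT (F⊆ u∈F)) (∈T⇒InT (F⊆ w∈F)))
    edge-in-D {a = a} {j} pole 1≤j j<p (inj₂ F⊆) u∈F w∈F =
      ≐-trans (D-flip a j (<⇒≤ j<p))
        (OfΔ1b⇒≐ (edge-pole pole (∸-monoʳ-< 1≤j (<⇒≤ j<p)) (∈T⇒InT (F⊆ u∈F)) (∈T⇒InT (F⊆ w∈F))))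

  module Links (b c : ℕ) (1≤b : 1 ≤ b) (b+c<p : b + c < p) where

    b<p : b < p
    b<p = ≤-<-trans (m≤m+n b c) b+c<p

    open MissingEdges b 1≤b b<p

    b+p∉Gj : ∀ {j} → b < j → j < p → v (b + p) ∉ Gj p j
    b+p∉Gj {j} b<j j<p h with ∈triangle⁻ h
    ... | inj₁ e = pole≢b+p (inj₂ refl) (sym (ρ-≋ (v-≋ e)))
    ... | inj₂ (inj₁ e) = <⇒≢ b<j (trans (sym ρ-b+p) (trans (ρ-≋ (v-≋ e)) (trans (ρ-+p j) (ρ-< j<p))))
    ... | inj₂ (inj₂ e) = <⇒≢ b<j (trans (sym ρ-b+p) (trans (ρ-≋ (v-≋ e)) (trans (ρ-+2p j) (ρ-< j<p))))

    no-edge : ∀ {u F} → Pole u → Del p b c F → v u ∈ F → v (b + p) ∈ F → ⊥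
    no-edge pole (inj₁ (inj₁ (zero , () , _))) u∈F w∈F
    no-edge pole (inj₁ (inj₁ (suc a , _ , _ , F⊆))) u∈F w∈F =
      pole≢b+p pole (trans (ρ-Σ (F⊆ u∈F)) (sym (ρ-Σ (F⊆ w∈F))))
    no-edge pole (inj₁ (inj₂ (_ , _ , ((zero , _ , () , _) , _) , _))) u∈F w∈F
    no-edge {F = F} pole
      (inj₁ (inj₂ (_ , _ , ((suc a , j , _ , _ , 1≤j , j≤p∸1 , eq) , excluded) , F∈Dij))) u∈F w∈F =
      excluded b 1≤b ≤-refl
        (≐-trans eq (≐-trans (Dij≐D a j (<⇒≤ j<p))
          (≐-trans (edge-in-D pole 1≤j j<p F∈D u∈F w∈F) (≐-sym (Dij≐D 0 b (<⇒≤ b<p))))))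
      where
      j<p : j < p
      j<p = m≤pred[n]⇒suc[m]≤n j≤p∸1
      F∈D : D a j F
      F∈D = Equivalence.to (Dij≐D a j (<⇒≤ j<p) F) (Equivalence.to (eq F) F∈Dij)
    no-edge pole (inj₂ (j , b+1≤j , j≤b+c , F⊆)) u∈F w∈F =
      b+p∉Gj (subst (_≤ j) (+-comm b 1) b+1≤j) (≤-<-trans j≤b+c b+c<p) (F⊆ w∈F)

    -- Δ(p+1, b) survives in 𝓜: its vertex 2p is not a vertex of any Δ(1,k).
    Δp+1,b∈𝓜 : InM p b (Dij p (suc p) b)
    Δp+1,b∈𝓜 = (suc p , b , s≤s z≤n , <2p⇒<n (m<m+n p 0<p) , 1≤b , <⇒≤pred b<p , ≐-refl) , excluded
      where
      excluded : ∀ k → 1 ≤ k → k ≤ b → ¬ (Dij p (suc p) b ≐ Dij p 1 k)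
      excluded k 1≤k k≤b eq = 2p∉D0k 1≤k k<p T∈D0k (∈₂ refl)
        where
        k<p : k < p
        k<p = ≤-<-trans k≤b b<p
        T∈D0k : D 0 k (T p b)
        T∈D0k = Equivalence.to (Dij≐D 0 k (<⇒≤ k<p) (T p b)) (Equivalence.to (eq (T p b)) (inj₁ (λ x → x)))

    0∉Gb : v 0 ∉ Gj p b
    0∉Gb h with ∈triangle⁻ h
    ... | inj₁ e = ¬0≋ 0<p (<2p⇒<n (m<m+n p 0<p)) (v-≋ e)
    ... | inj₂ (inj₁ e) = pole≢b+p (inj₁ refl) (ρ-≋ (v-≋ e))
    ... | inj₂ (inj₂ e) = pole≢b+p (inj₁ refl) (trans (ρ-≋ (v-≋ e)) (trans (ρ-+2p b) (sym (ρ-+p b))))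

    -- (i)  Δ ∩ ⟨G_b⟩ = ⟨{1+p, 1+b+2p}, {1+b+p, 1+b+2p}⟩: a face of G_b in Δ
    -- misses the edge {p, b+p}; conversely {p, b+2p} lies in Δ(p+1,b) and
    -- {b+p, b+2p} in the triangle of Σ through b.
    part-i : (Del p b c ∩ᶜ ⟨ Gj p b ⟩)
             ≐ (⟨ pair p (1 + p) (1 + b + 2 * p) ⟩ ∪ᶜ ⟨ pair p (1 + b + p) (1 + b + 2 * p) ⟩)
    part-i F = mk⇔ to from
      where
      to : (Del p b c ∩ᶜ ⟨ Gj p b ⟩) F →
           (⟨ pair p (1 + p) (1 + b + 2 * p) ⟩ ∪ᶜ ⟨ pair p (1 + b + p) (1 + b + 2 * p) ⟩) F
      to (F∈Δ , F⊆Gb) = avoid-edge F⊆Gb (λ (p∈F , b+p∈F) → no-edge (inj₂ refl) F∈Δ p∈F b+p∈F)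
      b+2p≋ : b + 2 * p ≋ p + b + p
      b+2p≋ = ≡⇒≋ (regroup b p)
        where
        regroup : ∀ b p → b + 2 * p ≡ p + b + p
        regroup = solve-∀
      from : (⟨ pair p (1 + p) (1 + b + 2 * p) ⟩ ∪ᶜ ⟨ pair p (1 + b + p) (1 + b + 2 * p) ⟩) F →
             (Del p b c ∩ᶜ ⟨ Gj p b ⟩) F
      from (inj₁ F⊆) =
          inj₁ (inj₂ (suc p , b , Δp+1,b∈𝓜 , inj₁ (⊆-trans F⊆ (edge-⊆ (∈₁ refl) (∈₃ (≋-v b+2p≋))))))
        , ⊆-trans F⊆ (edge-⊆ (∈₁ refl) (∈₃ refl))
      from (inj₂ F⊆) =
          inj₁ (inj₁ (suc b , s≤s z≤n , b<p , ⊆-trans F⊆ (edge-⊆ (∈₂ refl) (∈₃ refl))))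
        , ⊆-trans F⊆ (edge-⊆ (∈₂ refl) (∈₃ refl))

    -- (ii)  (Δ ∪ ⟨G_b⟩) ∩ ⟨{1, 1+p, 1+b+p}⟩ = ⟨{1, 1+p}, {1+p, 1+b+p}⟩: faces
    -- from Δ miss the edge {0, b+p}, faces from G_b miss the vertex 0;
    -- conversely {0, p} lies in the triangle of Σ through 0 and {p, b+p} in G_b.
    part-ii : ((Del p b c ∪ᶜ ⟨ Gj p b ⟩) ∩ᶜ ⟨ tri p 1 (1 + p) (1 + b + p) ⟩)
              ≐ (⟨ pair p 1 (1 + p) ⟩ ∪ᶜ ⟨ pair p (1 + p) (1 + b + p) ⟩)
    part-ii F = mk⇔ to from
      where
      to : ((Del p b c ∪ᶜ ⟨ Gj p b ⟩) ∩ᶜ ⟨ tri p 1 (1 + p) (1 + b + p) ⟩) F →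
           (⟨ pair p 1 (1 + p) ⟩ ∪ᶜ ⟨ pair p (1 + p) (1 + b + p) ⟩) F
      to (inj₂ F⊆Gb , F⊆) = inj₂ (drop-first F⊆ (λ 0∈F → 0∉Gb (F⊆Gb 0∈F)))
      to (inj₁ F∈Δ , F⊆) with avoid-edge (⊆-trans F⊆ (triangle-⊆ (∈₁ refl) (∈₃ refl) (∈₂ refl)))
                                          (λ (0∈F , b+p∈F) → no-edge (inj₁ refl) F∈Δ 0∈F b+p∈F)
      ... | inj₁ F⊆01 = inj₁ F⊆01
      ... | inj₂ F⊆21 = inj₂ (⊆-trans F⊆21 (edge-⊆ (∈ʳ refl) (∈ˡ refl)))
      from : (⟨ pair p 1 (1 + p) ⟩ ∪ᶜ ⟨ pair p (1 + p) (1 + b + p) ⟩) F →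
             ((Del p b c ∪ᶜ ⟨ Gj p b ⟩) ∩ᶜ ⟨ tri p 1 (1 + p) (1 + b + p) ⟩) F
      from (inj₁ F⊆) =
          inj₁ (inj₁ (inj₁ (1 , s≤s z≤n , 0<p , ⊆-trans F⊆ (edge-⊆ (∈₁ refl) (∈₂ refl)))))
        , ⊆-trans F⊆ (edge-⊆ (∈₁ refl) (∈₂ refl))
      from (inj₂ F⊆) =
          inj₂ (⊆-trans F⊆ (edge-⊆ (∈₁ refl) (∈₂ refl)))
        , ⊆-trans F⊆ (edge-⊆ (∈₂ refl) (∈₃ refl))

lemma3p7 : (p b c : ℕ) .{{_ : NonZero p}} → 2 ≤ p → 1 ≤ b → b + c ≤ p ∸ 2 →
    ((Del p b c ∩ᶜ ⟨ Gj p b ⟩)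
       ≐ (⟨ pair p (1 + p) (1 + b + 2 * p) ⟩ ∪ᶜ ⟨ pair p (1 + b + p) (1 + b + 2 * p) ⟩))
    × (((Del p b c ∪ᶜ ⟨ Gj p b ⟩) ∩ᶜ ⟨ tri p 1 (1 + p) (1 + b + p) ⟩)
       ≐ (⟨ pair p 1 (1 + p) ⟩ ∪ᶜ ⟨ pair p (1 + p) (1 + b + p) ⟩))
lemma3p7 p b c 2≤p 1≤b b+c≤p∸2 = part-i , part-ii
  where
  -- only b + c < p is needed
  b+c<p : b + c < p
  b+c<p = ≤-<-trans b+c≤p∸2 (∸-monoʳ-< (s≤s z≤n) 2≤p)
  open Geometry p
  open Links b c 1≤b b+c<p
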